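{- Let $D=(V,A)$ be a $\Gamma$ digraph with $n$ vertices $v_1,\dots,v_n$ and $m$ arcs $a_1,\dots,a_m$, and let $C=C_{nm}$ be its incidence matrix. Form the $2n\times m$ matrix $F=\begin{pmatrix} C^+\\ -C^-\end{pmatrix}$. Then $F$ is the incidence matrix of an undirected balanced bipartite graph $G(X,Y;E)$ (where $X$ corresponds to the first $n$ rows of $F$, $Y$ to the last $n$ rows, and the edge $e_j$ to column $j$) with the following properties: (c1) $|X|=n$, $|Y|=n$, $|E|=m$; (c2) $1\le d(x_i)\le 2$ for every $x_i\in X$, and $1\le d(y_i)\le 2$ for every $y_i\in Y$; (c3) $G$ has at most $\frac{n}{4}$ connected components that are cycles of length $4$.
   Context: All graphs are finite and simple (no multiple arcs, no loops). A $\Gamma$ digraph is a simple strongly connected digraph in which every vertex has indegree 1 or 2 and outdegree 2 or 1 respectively (the paper phrases this as "at most indegree 1 or 2 and outdegree 2 or 1"). The incidence matrix $C=(c_{ij})$ of a digraph with vertices $v_1,\dots,v_n$ and arcs $a_1,\dots,a_m$ is the $n\times m$ matrix with $c_{ij}=1$ if $a_j$ leaves $v_i$, $c_{ij}=-1$ if $a_j$ enters $v_i$, and $c_{ij}=0$ otherwise. $C^+$ is the $n\times m$ matrix obtained from $C$ by replacing all negative entries by $0$, and $C^-$ is obtained from $C$ by replacing all positive entries by $0$. The graph $G$ with incidence matrix $F$ is called the projector graph of $D$. -}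

module Defs where

open import Data.Nat using (ℕ; zero; suc; _+_; _*_; _≤_)
open import Data.Fin using (Fin; splitAt; _≟_)
open import Data.Fin.Subset using (Subset; _∈_)
open import Data.List using (List; length; filter; map; sum)
open import Data.List using () renaming (allFin to allFinL)
open import Data.Integer using (ℤ; 0ℤ; 1ℤ; -1ℤ; -_; _⊔_; _⊓_)
open import Data.Product using (Σ; ∃; _×_; _,_)
open import Data.Sum using (_⊎_; inj₁; inj₂; [_,_]′)
open import Data.Empty using (⊥)
open import Data.List.Relation.Unary.All using (All)
open import Data.List.Relation.Unary.Unique.Propositional using (Unique)
open import Relation.Nullary using (¬_; Dec; yes; no)
open import Relation.Nullary.Decidable using (⌊_⌋; _⊎-dec_)
open import Relation.Binary.PropositionalEquality using (_≡_; _≢_)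
open import Function.Bundles using (_⇔_)

count : ∀ {m} {P : Fin m → Set} → ((j : Fin m) → Dec (P j)) → ℕ
count {m} P? = length (filter P? (allFinL m))

record Digraph (n m : ℕ) : Set where
  field
    tail : Fin m → Fin n
    head : Fin m → Fin n
open Digraph public

IsSimpleDigraph : ∀ {n m} → Digraph n m → Set
IsSimpleDigraph D =
  (∀ j → tail D j ≢ head D j) ×
  (∀ j k → tail D j ≡ tail D k → head D j ≡ head D k → j ≡ k)

indeg outdeg : ∀ {n m} → Digraph n m → Fin n → ℕ
indeg  D v = count (λ j → head D j ≟ v)
outdeg D v = count (λ j → tail D j ≟ v)

data Walk {n m} (D : Digraph n m) : Fin n → Fin n → Set where
  stay : ∀ {u} → Walk D u u
  step : ∀ {u v} (j : Fin m) → tail D j ≡ u → Walk D (head D j) v → Walk D u v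

StronglyConnected : ∀ {n m} → Digraph n m → Set
StronglyConnected D = ∀ u v → Walk D u v

IsΓDigraph : ∀ {n m} → Digraph n m → Set
IsΓDigraph D = IsSimpleDigraph D × StronglyConnected D ×
  (∀ v → (indeg D v ≡ 1 × outdeg D v ≡ 2) ⊎ (indeg D v ≡ 2 × outdeg D v ≡ 1))

incidence : ∀ {n m} → Digraph n m → Fin n → Fin m → ℤ
incidence D i j with tail D j ≟ i | head D j ≟ i
... | yes _ | _     = 1ℤ
... | no _  | yes _ = -1ℤ
... | no _  | no _  = 0ℤ

C⁺ C⁻ : ∀ {n m} → Digraph n m → Fin n → Fin m → ℤ
C⁺ D i j = incidence D i j ⊔ 0ℤ
C⁻ D i j = incidence D i j ⊓ 0ℤ

Fmat : ∀ {n m} → Digraph n m → Fin (n + n) → Fin m → ℤ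
Fmat {n} D r j = [ (λ i → C⁺ D i j) , (λ i → - C⁻ D i j) ]′ (splitAt n r)

record UGraph (N m : ℕ) : Set where
  field
    end₁ : Fin m → Fin N
    end₂ : Fin m → Fin N
open UGraph public

IsEnd : ∀ {N m} → UGraph N m → Fin N → Fin m → Set
IsEnd G v j = end₁ G j ≡ v ⊎ end₂ G j ≡ v

isEnd? : ∀ {N m} (G : UGraph N m) v j → Dec (IsEnd G v j)
isEnd? G v j = (end₁ G j ≟ v) ⊎-dec (end₂ G j ≟ v)

IsSimpleUGraph : ∀ {N m} → UGraph N m → Set
IsSimpleUGraph G =
  (∀ j → end₁ G j ≢ end₂ G j) ×
  (∀ j k → (∀ v → IsEnd G v j ⇔ IsEnd G v k) → j ≡ k)

uincidence : ∀ {N m} → UGraph N m → Fin N → Fin m → ℤ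
uincidence G v j with isEnd? G v j
... | yes _ = 1ℤ
... | no _  = 0ℤ

deg : ∀ {N m} → UGraph N m → Fin N → ℕ
deg G v = count (isEnd? G v)

Adj : ∀ {N m} → UGraph N m → Fin N → Fin N → Set
Adj G u v = ∃ λ j → (end₁ G j ≡ u × end₂ G j ≡ v) ⊎ (end₁ G j ≡ v × end₂ G j ≡ u)

InX : ∀ n → Fin (n + n) → Set
InX n v = ∃ λ i → splitAt n v ≡ inj₁ i

InY : ∀ n → Fin (n + n) → Set
InY n v = ∃ λ i → splitAt n v ≡ inj₂ i

IsBipartiteXY : ∀ n {m} → UGraph (n + n) m → Set
IsBipartiteXY n G = ∀ j →
  (InX n (end₁ G j) × InY n (end₂ G j)) ⊎ (InY n (end₁ G j) × InX n (end₂ G j))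

-- S is the vertex set of a connected component of G which is a cycle of
-- length 4: S = {v0,v1,v2,v3} distinct, v0v1v2v3v0 is a cycle, no chords,
-- and S is closed under adjacency (so it is a whole component).
IsC4Component : ∀ {N m} → UGraph N m → Subset N → Set
IsC4Component G S = Σ _ λ v0 → Σ _ λ v1 → Σ _ λ v2 → Σ _ λ v3 →
  (v0 ≢ v1) × (v0 ≢ v2) × (v0 ≢ v3) × (v1 ≢ v2) × (v1 ≢ v3) × (v2 ≢ v3) ×
  (∀ w → (w ∈ S) ⇔ (w ≡ v0 ⊎ w ≡ v1 ⊎ w ≡ v2 ⊎ w ≡ v3)) ×
  Adj G v0 v1 × Adj G v1 v2 × Adj G v2 v3 × Adj G v3 v0 ×
  ¬ Adj G v0 v2 × ¬ Adj G v1 v3 ×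
  (∀ u w → u ∈ S → Adj G u w → w ∈ S)

module Submission where

-- The projector graph of a digraph D with n vertices and m arcs is the
-- undirected graph G on X ⊎ Y = Fin (n + n) in which arc j, from u to v,
-- becomes the edge x_u y_v.  Its incidence matrix is F = (C⁺ ; -C⁻): row
-- x_u records the arcs leaving u and row y_v the arcs entering v.  Hence
-- G is bipartite with |X| = |Y| = n, deg x_u = outdeg u and deg y_v = indeg v,
-- and G is simple whenever D is.  For a Γ digraph every degree of G is 1 or 2.
--
-- For (c3), the four corners of a C4 component all have degree 2, and two
-- C4 components sharing a vertex coincide, so k distinct C4 components
-- contribute 4k distinct vertices of degree 2.  Folding x_u and y_u to u is
-- injective on vertices of degree 2, since no vertex of a Γ digraph has
-- indegree and outdegree both 2.  So the 4k vertices fold to 4k distinct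
-- elements of Fin n, giving 4k ≤ n.

open import Defs
open import Data.Nat using (ℕ; _+_; _*_; _≤_; s≤s; z≤n)
open import Data.Nat.Properties using (*-suc)
open import Data.Fin using (Fin; _↑ˡ_; _↑ʳ_; splitAt; join) renaming (_≟_ to _≟F_)
open import Data.Fin.Properties
  using (splitAt-↑ˡ; splitAt-↑ʳ; join-splitAt; ↑ˡ-injective; ↑ʳ-injective; injective⇒≤)
open import Data.Fin.Subset using (Subset; _∈_; _⊆_)
open import Data.Fin.Subset.Properties using (⊆-antisym)
open import Data.List using (List; []; _∷_; _++_; length; map; lookup)
  renaming (allFin to allFinL)
open import Data.List.Properties using (length-map; length-++; filter-≐)
open import Data.List.Membership.Propositional using () renaming (_∈_ to _∈ₗ_)
open import Data.List.Membership.Propositional.Properties using (∈-allFin; ∈-filter⁺; ∈-lookup)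
open import Data.List.Relation.Unary.Any using (Any; here; there)
open import Data.List.Relation.Unary.All using (All; []; _∷_)
import Data.List.Relation.Unary.All as All
import Data.List.Relation.Unary.All.Properties as All
open import Data.List.Relation.Unary.AllPairs using (AllPairs; []; _∷_)
import Data.List.Relation.Unary.AllPairs.Properties as AllPairs
open import Data.List.Relation.Unary.Unique.Propositional using (Unique)
open import Data.Integer using (0ℤ; 1ℤ; -_)
open import Data.Product using (Σ; _×_; _,_; proj₁; proj₂)
open import Data.Sum using (_⊎_; inj₁; inj₂; [_,_]′)
import Data.Sum as Sum
open import Data.Empty using (⊥; ⊥-elim)
open import Relation.Nullary using (¬_; yes; no)
open import Relation.Unary using (Decidable)
open import Relation.Binary.PropositionalEquality
  using (_≡_; _≢_; refl; sym; trans; cong; subst)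
open import Function using (_∘_; id; _on_)
open import Function.Bundles using (Equivalence)

module _ {A : Set} where

  distinct-members⇒2≤length : ∀ {a b : A} {xs} → a ∈ₗ xs → b ∈ₗ xs → a ≢ b →
    2 ≤ length xs
  distinct-members⇒2≤length {xs = _ ∷ _ ∷ _} _ _ _ = s≤s (s≤s z≤n)
  distinct-members⇒2≤length {xs = _ ∷ []} (here refl) (here refl) a≢b = ⊥-elim (a≢b refl)

  lookup-injective : ∀ {xs : List A} → Unique xs → ∀ {i j} → lookup xs i ≡ lookup xs j → i ≡ j
  lookup-injective (_  ∷ _)   {Fin.zero}  {Fin.zero}  _  = refl
  lookup-injective (x∉ ∷ _)   {Fin.zero}  {Fin.suc j} eq = ⊥-elim (All.lookup x∉ (∈-lookup j) eq)
  lookup-injective (x∉ ∷ _)   {Fin.suc i} {Fin.zero}  eq = ⊥-elim (All.lookup x∉ (∈-lookup i) (sym eq))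
  lookup-injective (_  ∷ xs!) {Fin.suc i} {Fin.suc j} eq = cong Fin.suc (lookup-injective xs! eq)

  map-unique : ∀ {B : Set} {Q : A → Set} (f : A → B) →
    (∀ {x y} → Q x → Q y → f x ≡ f y → x ≡ y) →
    ∀ {xs} → All Q xs → Unique xs → Unique (map f xs)
  map-unique {Q = Q} f f-inj qs xs! = AllPairs.map⁺ (restrict qs xs!)
    where
    restrict : ∀ {xs} → All Q xs → Unique xs → AllPairs (_≢_ on f) xs
    restrict [] [] = []
    restrict (qx ∷ qs) (x∉ ∷ xs!) =
      All.zipWith (λ (qy , x≢y) → x≢y ∘ f-inj qx qy) (qs , x∉) ∷ restrict qs xs!

unique⇒length≤ : ∀ {n} {xs : List (Fin n)} → Unique xs → length xs ≤ n
unique⇒length≤ xs! = injective⇒≤ (lookup-injective xs!)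

module _ {m : ℕ} where

  count-≐ : {P Q : Fin m → Set} (P? : Decidable P) (Q? : Decidable Q) →
    (∀ {j} → P j → Q j) → (∀ {j} → Q j → P j) → count P? ≡ count Q?
  count-≐ P? Q? P⇒Q Q⇒P = cong length (filter-≐ P? Q? (P⇒Q , Q⇒P) (allFinL m))

  2≤count : {P : Fin m → Set} (P? : Decidable P) {j k : Fin m} →
    P j → P k → j ≢ k → 2 ≤ count P?
  2≤count P? {j} {k} pj pk =
    distinct-members⇒2≤length (∈-filter⁺ P? (∈-allFin j) pj) (∈-filter⁺ P? (∈-allFin k) pk)

module C4Components {N m : ℕ} (G : UGraph N m) where

  C4 : Subset N → Set
  C4 = IsC4Component G

  adj-sym : ∀ {u v} → Adj G u v → Adj G v u
  adj-sym (j , inj₁ p) = j , inj₂ p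
  adj-sym (j , inj₂ p) = j , inj₁ p

  same-edge⇒same-neighbour : ∀ {u a b j} →
    (end₁ G j ≡ u × end₂ G j ≡ a) ⊎ (end₁ G j ≡ a × end₂ G j ≡ u) →
    (end₁ G j ≡ u × end₂ G j ≡ b) ⊎ (end₁ G j ≡ b × end₂ G j ≡ u) → a ≡ b
  same-edge⇒same-neighbour (inj₁ (_ , a))  (inj₁ (_ , b))  = trans (sym a) b
  same-edge⇒same-neighbour (inj₁ (u , a))  (inj₂ (b , u′)) = trans (sym a) (trans u′ (trans (sym u) b))
  same-edge⇒same-neighbour (inj₂ (a , u))  (inj₁ (u′ , b)) = trans (sym a) (trans u′ (trans (sym u) b))
  same-edge⇒same-neighbour (inj₂ (a , _))  (inj₂ (b , _))  = trans (sym a) b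

  two-neighbours⇒2≤deg : ∀ {u a b} → Adj G u a → Adj G u b → a ≢ b → 2 ≤ deg G u
  two-neighbours⇒2≤deg (j , ja) (k , kb) a≢b =
    2≤count (isEnd? G _) (at-u ja) (at-u kb) (λ { refl → a≢b (same-edge⇒same-neighbour ja kb) })
    where
    at-u : ∀ {u c j} → (end₁ G j ≡ u × end₂ G j ≡ c) ⊎ (end₁ G j ≡ c × end₂ G j ≡ u) → IsEnd G u j
    at-u (inj₁ (p , _)) = inj₁ p
    at-u (inj₂ (_ , p)) = inj₂ p

  corners : ∀ {S} → C4 S → List (Fin N)
  corners (v0 , v1 , v2 , v3 , _) = v0 ∷ v1 ∷ v2 ∷ v3 ∷ []

  corners-distinct : ∀ {S} (c : C4 S) → Unique (corners c)
  corners-distinct (_ , _ , _ , _ , d01 , d02 , d03 , d12 , d13 , d23 , _) =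
    (d01 ∷ d02 ∷ d03 ∷ []) ∷ (d12 ∷ d13 ∷ []) ∷ (d23 ∷ []) ∷ [] ∷ []

  corners-in : ∀ {S} (c : C4 S) → All (_∈ S) (corners c)
  corners-in (v0 , v1 , v2 , v3 , _ , _ , _ , _ , _ , _ , mem , _) =
    in-S (inj₁ refl) ∷ in-S (inj₂ (inj₁ refl)) ∷
    in-S (inj₂ (inj₂ (inj₁ refl))) ∷ in-S (inj₂ (inj₂ (inj₂ refl))) ∷ []
    where in-S = λ {w} → Equivalence.from (mem w)

  -- Each corner has its two cycle neighbours, which are distinct.
  corners-deg : ∀ {S} (c : C4 S) → All (λ w → 2 ≤ deg G w) (corners c)
  corners-deg (_ , _ , _ , _ , _ , d02 , _ , _ , d13 , _ , _ , a01 , a12 , a23 , a30 , _) =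
    two-neighbours⇒2≤deg a01 (adj-sym a30) d13 ∷
    two-neighbours⇒2≤deg a12 (adj-sym a01) (d02 ∘ sym) ∷
    two-neighbours⇒2≤deg a23 (adj-sym a12) (d13 ∘ sym) ∷
    two-neighbours⇒2≤deg a30 (adj-sym a23) d02 ∷ []

  C4-⊆-closed : ∀ {S T w} → C4 S → (∀ u v → u ∈ T → Adj G u v → v ∈ T) →
    w ∈ S → w ∈ T → S ⊆ T
  C4-⊆-closed {S} {T} {w} (v0 , v1 , v2 , v3 , _ , _ , _ , _ , _ , _ , mem , a01 , a12 , a23 , a30 , _)
      closed w∈S w∈T {x} x∈S = corner (Equivalence.to (mem x) x∈S)
    where
    propagate : ∀ {a b} → Adj G a b → a ∈ T → b ∈ T
    propagate ab a∈T = closed _ _ a∈T ab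
    v0∈T : v0 ∈ T
    v0∈T with Equivalence.to (mem w) w∈S
    ... | inj₁ refl                = w∈T
    ... | inj₂ (inj₁ refl)         = propagate (adj-sym a01) w∈T
    ... | inj₂ (inj₂ (inj₁ refl))  = propagate a30 (propagate a23 w∈T)
    ... | inj₂ (inj₂ (inj₂ refl))  = propagate a30 w∈T
    corner : x ≡ v0 ⊎ x ≡ v1 ⊎ x ≡ v2 ⊎ x ≡ v3 → x ∈ T
    corner (inj₁ refl)               = v0∈T
    corner (inj₂ (inj₁ refl))        = propagate a01 v0∈T
    corner (inj₂ (inj₂ (inj₁ refl))) = propagate a12 (propagate a01 v0∈T)
    corner (inj₂ (inj₂ (inj₂ refl))) = propagate a23 (propagate a12 (propagate a01 v0∈T))

  C4-share⇒≡ : ∀ {S S′ w} → C4 S → C4 S′ → w ∈ S → w ∈ S′ → S ≡ S′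
  C4-share⇒≡ c c′ w∈S w∈S′ =
    ⊆-antisym (C4-⊆-closed c (closed c′) w∈S w∈S′) (C4-⊆-closed c′ (closed c) w∈S′ w∈S)
    where
    closed : ∀ {S} → C4 S → ∀ u v → u ∈ S → Adj G u v → v ∈ S
    closed (_ , _ , _ , _ , _ , _ , _ , _ , _ , _ , _ , _ , _ , _ , _ , _ , _ , cl) = cl

  outside-other-components : ∀ {S w L} → C4 S → w ∈ S → All (S ≢_) L → All C4 L →
    ¬ Any (w ∈_) L
  outside-other-components c w∈S (S≢S′ ∷ _) (c′ ∷ _) (here w∈S′) = S≢S′ (C4-share⇒≡ c c′ w∈S w∈S′)
  outside-other-components c w∈S (_ ∷ S≢L) (_ ∷ cs) (there w∈L) = outside-other-components c w∈S S≢L cs w∈L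

  vertices : ∀ {L} → All C4 L → List (Fin N)
  vertices []       = []
  vertices (c ∷ cs) = corners c ++ vertices cs

  vertices-length : ∀ {L} (cs : All C4 L) → length (vertices cs) ≡ 4 * length L
  vertices-length [] = refl
  vertices-length {_ ∷ L} (c ∷ cs) =
    trans (length-++ (corners c) {vertices cs}) (trans (cong (4 +_) (vertices-length cs)) (sym (*-suc 4 (length L))))

  vertices-in : ∀ {L} (cs : All C4 L) → All (λ w → Any (w ∈_) L) (vertices cs)
  vertices-in []       = []
  vertices-in (c ∷ cs) = All.++⁺ (All.map here (corners-in c)) (All.map there (vertices-in cs))

  vertices-deg : ∀ {L} (cs : All C4 L) → All (λ w → 2 ≤ deg G w) (vertices cs)
  vertices-deg []       = []
  vertices-deg (c ∷ cs) = All.++⁺ (corners-deg c) (vertices-deg cs)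

  -- Distinct components are disjoint, so their corners are all distinct.
  vertices-unique : ∀ {L} → Unique L → (cs : All C4 L) → Unique (vertices cs)
  vertices-unique [] [] = []
  vertices-unique {S ∷ L} (S≢L ∷ L!) (c ∷ cs) =
    AllPairs.++⁺ (corners-distinct c) (vertices-unique L! cs)
      (All.map (λ x∈S → All.map (apart x∈S) (vertices-in cs)) (corners-in c))
    where
    apart : ∀ {x y} → x ∈ S → Any (y ∈_) L → x ≢ y
    apart x∈S y∈L refl = outside-other-components c x∈S S≢L cs y∈L

  C4-count-bound : ∀ {k} (f : Fin N → Fin k) →
    (∀ {x y} → 2 ≤ deg G x → 2 ≤ deg G y → f x ≡ f y → x ≡ y) →
    ∀ {L} → Unique L → All C4 L → 4 * length L ≤ k
  C4-count-bound f f-inj L! cs =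
    subst (_≤ _) (trans (length-map f (vertices cs)) (vertices-length cs))
      (unique⇒length≤ (map-unique f f-inj (vertices-deg cs) (vertices-unique L! cs)))

data Side (n : ℕ) : Fin (n + n) → Set where
  inX : ∀ i → Side n (i ↑ˡ n)
  inY : ∀ i → Side n (n ↑ʳ i)

side : ∀ n r → Side n r
side n r = subst (Side n) (join-splitAt n n r) (from-split (splitAt n r))
  where
  from-split : (s : Fin n ⊎ Fin n) → Side n (join n n s)
  from-split (inj₁ i) = inX i
  from-split (inj₂ i) = inY i

X≢Y : ∀ n {i j : Fin n} → i ↑ˡ n ≢ n ↑ʳ j
X≢Y n {i} {j} e with trans (sym (splitAt-↑ˡ n i n)) (trans (cong (splitAt n) e) (splitAt-↑ʳ n n j))
... | ()

fold : ∀ n → Fin (n + n) → Fin n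
fold n r = [ id , id ]′ (splitAt n r)

fold-X : ∀ n i → fold n (i ↑ˡ n) ≡ i
fold-X n i rewrite splitAt-↑ˡ n i n = refl

fold-Y : ∀ n i → fold n (n ↑ʳ i) ≡ i
fold-Y n i rewrite splitAt-↑ʳ n n i = refl

projector : ∀ {n m} → Digraph n m → UGraph (n + n) m
projector {n} D = record { end₁ = λ j → tail D j ↑ˡ n ; end₂ = λ j → n ↑ʳ head D j }

module Projector {n m : ℕ} (D : Digraph n m) where

  G : UGraph (n + n) m
  G = projector D

  endX⇒tail : ∀ {i j} → IsEnd G (i ↑ˡ n) j → tail D j ≡ i
  endX⇒tail (inj₁ e) = ↑ˡ-injective n _ _ e
  endX⇒tail (inj₂ e) = ⊥-elim (X≢Y n (sym e))

  tail⇒endX : ∀ {i j} → tail D j ≡ i → IsEnd G (i ↑ˡ n) j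
  tail⇒endX e = inj₁ (cong (_↑ˡ n) e)

  endY⇒head : ∀ {i j} → IsEnd G (n ↑ʳ i) j → head D j ≡ i
  endY⇒head (inj₁ e) = ⊥-elim (X≢Y n e)
  endY⇒head (inj₂ e) = ↑ʳ-injective n _ _ e

  head⇒endY : ∀ {i j} → head D j ≡ i → IsEnd G (n ↑ʳ i) j
  head⇒endY e = inj₂ (cong (n ↑ʳ_) e)

  deg-X : ∀ i → deg G (i ↑ˡ n) ≡ outdeg D i
  deg-X i = count-≐ (isEnd? G (i ↑ˡ n)) (λ j → tail D j ≟F i) endX⇒tail tail⇒endX

  deg-Y : ∀ i → deg G (n ↑ʳ i) ≡ indeg D i
  deg-Y i = count-≐ (isEnd? G (n ↑ʳ i)) (λ j → head D j ≟F i) endY⇒head head⇒endY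

  bipartite : IsBipartiteXY n G
  bipartite j = inj₁ ((tail D j , splitAt-↑ˡ n (tail D j) n) , (head D j , splitAt-↑ʳ n n (head D j)))

  -- G is simple because D has no multiple arcs (loops are impossible across X and Y).
  simple : IsSimpleDigraph D → IsSimpleUGraph G
  simple (_ , no-multiple) =
    (λ j → X≢Y n) ,
    (λ j k ends → no-multiple j k
      (sym (endX⇒tail (Equivalence.to (ends (tail D j ↑ˡ n)) (inj₁ refl))))
      (sym (endY⇒head (Equivalence.to (ends (n ↑ʳ head D j)) (inj₂ refl)))))

  uincidence-end : ∀ {v j} → IsEnd G v j → uincidence G v j ≡ 1ℤ
  uincidence-end {v} {j} p with isEnd? G v j
  ... | yes _ = refl
  ... | no ¬p = ⊥-elim (¬p p)

  uincidence-non-end : ∀ {v j} → ¬ IsEnd G v j → uincidence G v j ≡ 0ℤ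
  uincidence-non-end {v} {j} ¬p with isEnd? G v j
  ... | yes p = ⊥-elim (¬p p)
  ... | no _  = refl

  incidence-X : ∀ i j → uincidence G (i ↑ˡ n) j ≡ C⁺ D i j
  incidence-X i j with tail D j ≟F i | head D j ≟F i
  ... | yes t | _     = uincidence-end (tail⇒endX t)
  ... | no ¬t | yes _ = uincidence-non-end (¬t ∘ endX⇒tail)
  ... | no ¬t | no _  = uincidence-non-end (¬t ∘ endX⇒tail)

  -- Row y_i is row i of -C⁻; here a loop would give C = 1 instead of -1.
  incidence-Y : (∀ j → tail D j ≢ head D j) → ∀ i j → uincidence G (n ↑ʳ i) j ≡ - C⁻ D i j
  incidence-Y no-loop i j with tail D j ≟F i | head D j ≟F i
  ... | yes refl | yes h  = ⊥-elim (no-loop j (sym h))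
  ... | yes _    | no ¬h  = uincidence-non-end (¬h ∘ endY⇒head)
  ... | no _     | yes h  = uincidence-end (head⇒endY h)
  ... | no _     | no ¬h  = uincidence-non-end (¬h ∘ endY⇒head)

  incidence-F : (∀ j → tail D j ≢ head D j) → ∀ r j → uincidence G r j ≡ Fmat D r j
  incidence-F no-loop r j with side n r
  ... | inX i rewrite splitAt-↑ˡ n i n = incidence-X i j
  ... | inY i rewrite splitAt-↑ʳ n n i = incidence-Y no-loop i j

  one-or-two : ∀ {d} → d ≡ 1 ⊎ d ≡ 2 → 1 ≤ d × d ≤ 2
  one-or-two (inj₁ refl) = s≤s z≤n , s≤s z≤n
  one-or-two (inj₂ refl) = s≤s z≤n , s≤s (s≤s z≤n)

  module _ (degs : ∀ v → (indeg D v ≡ 1 × outdeg D v ≡ 2) ⊎ (indeg D v ≡ 2 × outdeg D v ≡ 1)) where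

    -- Every degree of G is an in- or outdegree of D, hence 1 or 2.
    deg-bounds : ∀ v → 1 ≤ deg G v × deg G v ≤ 2
    deg-bounds v with side n v
    ... | inX i rewrite deg-X i = one-or-two (Sum.map proj₂ proj₂ (Sum.swap (degs i)))
    ... | inY i rewrite deg-Y i = one-or-two (Sum.map proj₁ proj₁ (degs i))

    not-both-2 : ∀ i → 2 ≤ outdeg D i → 2 ≤ indeg D i → ⊥
    not-both-2 i out≥2 in≥2 with degs i
    ... | inj₁ (in≡1 , _) with subst (2 ≤_) in≡1 in≥2
    ...   | s≤s ()
    not-both-2 i out≥2 in≥2 | inj₂ (_ , out≡1) with subst (2 ≤_) out≡1 out≥2
    ...   | s≤s ()

    x-y-not-both-2 : ∀ {i k} → i ≡ k → 2 ≤ deg G (i ↑ˡ n) → 2 ≤ deg G (n ↑ʳ k) → ⊥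
    x-y-not-both-2 {i} refl dx dy = not-both-2 i (subst (2 ≤_) (deg-X i) dx) (subst (2 ≤_) (deg-Y i) dy)

    fold-injective : ∀ {x y} → 2 ≤ deg G x → 2 ≤ deg G y → fold n x ≡ fold n y → x ≡ y
    fold-injective {x} {y} dx dy eq with side n x | side n y
    ... | inX i | inX k = cong (_↑ˡ n) (trans (sym (fold-X n i)) (trans eq (fold-X n k)))
    ... | inY i | inY k = cong (n ↑ʳ_) (trans (sym (fold-Y n i)) (trans eq (fold-Y n k)))
    ... | inX i | inY k = ⊥-elim (x-y-not-both-2 (trans (sym (fold-X n i)) (trans eq (fold-Y n k))) dx dy)
    ... | inY i | inX k = ⊥-elim (x-y-not-both-2 (trans (sym (fold-X n k)) (trans (sym eq) (fold-Y n i))) dy dx)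

theorem1 : ∀ {n m} (D : Digraph n m) → IsΓDigraph D →
    Σ (UGraph (n + n) m) λ G →
      IsSimpleUGraph G × IsBipartiteXY n G ×
      (∀ r j → uincidence G r j ≡ Fmat D r j) ×
      (∀ v → 1 ≤ deg G v × deg G v ≤ 2) ×
      (∀ (L : List (Subset (n + n))) → Unique L → All (IsC4Component G) L →
        4 * length L ≤ n)
theorem1 {n} D (D-simple , _ , degs) =
  projector D ,
  simple D-simple ,
  bipartite ,
  incidence-F (proj₁ D-simple) ,
  deg-bounds degs ,
  λ L L! cs → C4Components.C4-count-bound (projector D) (fold n) (fold-injective degs) L! cs
  where open Projector D
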